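{- Let $\psi\in\mathcal{F}$ and let $(\tilde u_n)_{n\ge1}$ be an increasing sequence of positive integers such that $\tilde u_{n+1}=2\tilde u_n-\tilde u_{\psi(n)}$ for every sufficiently large $n$. Then $\liminf_{n\to\infty}\tilde u_{n+1}/\tilde u_n>1$ and $\limsup_{n\to\infty}\tilde u_{n+1}/\tilde u_n=\delta(\psi)$.
   Context: The set $\mathcal{F}$: functions $\psi:\mathbb{N}^*\to\mathbb{N}$ such that there is $c$ with $i-c\le\psi(i)\le i-1$ for all $i\ge1$; there are infinitely many $i$ with $\psi(i)\le i-2$; and, letting $(\vartheta_k)$ be the increasing sequence of all $n$ with $\psi(n)\le n-2$, $\psi(\vartheta_k)<\vartheta_{k-1}$ and $\psi(\vartheta_k)\ne\psi(\vartheta_{k-1})$ for all sufficiently large $k$. For $\psi\in\mathcal{F}$, $\delta(\psi)=\limsup_{i\to\infty}m_{i+1}/m_i$, where $(m_i)_{i\ge1}$ is any increasing sequence of non-negative integers with $m_{i+1}=2m_i-m_{\psi(i)}$ for all sufficiently large $i$ (independent of the choice of $(m_i)$). -}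

module Defs where

open import Data.Nat using (ℕ; zero; suc; _+_; _*_; _≤_; _<_)
open import Data.Product using (Σ; ∃; ∃-syntax; _×_)
open import Relation.Nullary using (¬_)
open import Relation.Binary.PropositionalEquality using (_≡_; _≢_)
open import Function.Bundles using (_⇔_)

-- Functions ψ : ℕ* → ℕ are modelled as ℕ → ℕ; the value at 0 is ignored.

Exc : (ℕ → ℕ) → ℕ → Set
Exc ψ n = 1 ≤ n × ψ n + 2 ≤ n

-- The condition on the increasing enumeration
-- (ϑ_k) of exceptional indices "for all sufficiently large k" is written
-- via consecutive exceptional indices n' = ϑ_{k-1} < n = ϑ_k with n' ≥ N.
record InF (ψ : ℕ → ℕ) : Set where
  field
    bounded   : ∃[ c ] (∀ i → 1 ≤ i → i ≤ ψ i + c × ψ i < i)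
    infExc    : ∀ N → ∃[ i ] (N ≤ i × Exc ψ i)
    thetaCond : ∃[ N ] (∀ n' n → N ≤ n' → n' < n → Exc ψ n' → Exc ψ n →
                  (∀ j → n' < j → j < n → ¬ Exc ψ j) →
                  ψ n < n' × ψ n ≢ ψ n')

StrictInc : (ℕ → ℕ) → Set
StrictInc a = ∀ n → 1 ≤ n → a n < a (suc n)

EventRec : (ℕ → ℕ) → (ℕ → ℕ) → Set
EventRec ψ a = ∃[ N ] (∀ n → N ≤ n → a (suc n) + a (ψ n) ≡ 2 * a n)

-- limsup_{n} a(n+1)/a(n) < p/s   (s > 0), i.e. there is a rational
-- p'/s' < p/s with a(n+1)/a(n) ≤ p'/s' for all sufficiently large n.
-- Ratios are compared by cross-multiplication.
LimsupBelow : (ℕ → ℕ) → ℕ → ℕ → Set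
LimsupBelow a p s =
  ∃[ p' ] ∃[ s' ] (1 ≤ s' × p' * s < p * s' ×
    ∃[ N ] (∀ n → N ≤ n → s' * a (suc n) ≤ p' * a n))

-- liminf_{n} a(n+1)/a(n) > 1: some rational p/s > 1 with
-- a(n+1)/a(n) ≥ p/s for all sufficiently large n.
LiminfAboveOne : (ℕ → ℕ) → Set
LiminfAboveOne a =
  ∃[ p ] ∃[ s ] (1 ≤ s × s < p ×
    ∃[ N ] (∀ n → N ≤ n → p * a n ≤ s * a (suc n)))

-- limsup a(n+1)/a(n) = δ(ψ): δ(ψ) is the limsup of m(i+1)/m(i) for any
-- increasing sequence (m_i) of non-negative integers with
-- m(i+1) = 2 m(i) - m(ψ i) eventually. Equality of the two (finite) limsups
-- is expressed as equality of their strict upper rational cuts.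
LimsupIsDelta : (ℕ → ℕ) → (ℕ → ℕ) → Set
LimsupIsDelta ψ u =
  (m : ℕ → ℕ) → StrictInc m → EventRec ψ m →
  ∀ p s → 1 ≤ s → LimsupBelow u p s ⇔ LimsupBelow m p s

{-# OPTIONS --safe #-}
-- The recurrence looks back at most c steps (i − c ≤ ψ i < i), so it preserves the cone of
-- sequences that are nonnegative and nondecreasing on c + 1 consecutive indices, and inside
-- that cone differences are nondecreasing.  Exceptional indices (ψ n ≤ n − 2) eventually occur
-- in every window of length c, and at each of them the difference is at least the sum of two
-- earlier ones; so Δy doubles every c steps and an increasing solution satisfies y n ≤ C·Δy n,
-- i.e. y (n + 1) / y n ≥ 1 + 1/C.
-- For the limsup, two increasing solutions x, y are squeezed: D·x − a·y and (a + g)·y − D·x are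
-- kept in the cone, and each round the one carrying at least half of g·Δy absorbs −g·y.  This
-- multiplies a by K but g only by K − 1, so eventually a·y ≤ D·x ≤ (a + g)·y with g/a as small as
-- we like; then x (n + 1) / x n ≤ (1 + ε)·y (n + 1) / y n, and symmetrically.
module Submission where

open import Defs
open import Data.Nat.Base as ℕ using (ℕ; zero; suc; z≤n; s≤s; _∸_; _^_; _⊔_)
import Data.Nat.Properties as ℕ
import Data.Nat.Tactic.RingSolver as ℕ
open import Data.Nat.Induction using (<-rec)
open import Data.Product using (∃-syntax; _×_; _,_; proj₁; proj₂)
open import Data.Sum using (_⊎_; inj₁; inj₂)
open import Function.Bundles using (mk⇔)
open import Relation.Binary.PropositionalEquality
  using (_≡_; refl; sym; trans; cong; cong₂; subst; subst₂)
open import Relation.Nullary using (¬_; yes; no; contradiction)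
open import Relation.Nullary.Decidable using (_×-dec_)
open import Relation.Unary using (Decidable)

Eventually : (ℕ → Set) → Set
Eventually P = ∃[ N ] (∀ n → N ℕ.≤ n → P n)

eventually-× : ∀ {P Q : ℕ → Set} → Eventually P → Eventually Q → Eventually (λ n → P n × Q n)
eventually-× (M , p) (N , q) =
  M ⊔ N , λ n M⊔N≤n → p n (ℕ.m⊔n≤o⇒m≤o M N M⊔N≤n) , q n (ℕ.m⊔n≤o⇒n≤o M N M⊔N≤n)

least-from : ∀ {P : ℕ → Set} → Decidable P → ∀ k d → P (d ℕ.+ k) →
             ∃[ q ] (k ℕ.≤ q × P q × (∀ j → k ℕ.≤ j → j ℕ.< q → ¬ P j))
least-from P? k zero Pk = k , ℕ.≤-refl , Pk , λ j k≤j j<k → contradiction k≤j (ℕ.<⇒≱ j<k)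
least-from {P} P? k (suc d) P[1+d+k] with P? k
... | yes Pk = k , ℕ.≤-refl , Pk , λ j k≤j j<k → contradiction k≤j (ℕ.<⇒≱ j<k)
... | no ¬Pk with least-from P? (suc k) d (subst P (sym (ℕ.+-suc d k)) P[1+d+k])
...   | q , k<q , Pq , none-below = q , ℕ.<⇒≤ k<q , Pq , none-below′
  where
  none-below′ : ∀ j → k ℕ.≤ j → j ℕ.< q → ¬ P j
  none-below′ j k≤j j<q with ℕ.m≤n⇒m<n∨m≡n k≤j
  ... | inj₁ k<j = none-below j k<j j<q
  ... | inj₂ refl = ¬Pk

strictInc-positive : ∀ {y} → StrictInc y → ∀ n → 2 ℕ.≤ n → 1 ℕ.≤ y n
strictInc-positive y-inc (suc zero) (s≤s ())
strictInc-positive y-inc (suc (suc n)) _ = ℕ.≤-trans (s≤s z≤n) (y-inc (suc n) (s≤s z≤n))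

bernoulli : ∀ J t → J ^ t ℕ.* (J ℕ.+ t) ℕ.≤ J ℕ.* suc J ^ t
bernoulli J zero = ℕ.≤-reflexive (base J)
  where
  base : ∀ J → 1 ℕ.* (J ℕ.+ 0) ≡ J ℕ.* 1
  base = ℕ.solve-∀
bernoulli J (suc t) = begin
  J ℕ.* J ^ t ℕ.* (J ℕ.+ suc t)                      ≤⟨ ℕ.m≤m+n _ (J ^ t ℕ.* t) ⟩
  J ℕ.* J ^ t ℕ.* (J ℕ.+ suc t) ℕ.+ J ^ t ℕ.* t      ≡⟨ expand J t (J ^ t) ⟩
  suc J ℕ.* (J ^ t ℕ.* (J ℕ.+ t))                    ≤⟨ ℕ.*-monoʳ-≤ (suc J) (bernoulli J t) ⟩
  suc J ℕ.* (J ℕ.* suc J ^ t)                        ≡⟨ swap J (suc J ^ t) ⟩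
  J ℕ.* (suc J ℕ.* suc J ^ t)                        ∎
  where
  open ℕ.≤-Reasoning
  expand : ∀ J t P → J ℕ.* P ℕ.* (J ℕ.+ suc t) ℕ.+ P ℕ.* t ≡ suc J ℕ.* (P ℕ.* (J ℕ.+ t))
  expand = ℕ.solve-∀
  swap : ∀ J Q → suc J ℕ.* (J ℕ.* Q) ≡ J ℕ.* (suc J ℕ.* Q)
  swap = ℕ.solve-∀

power-gap : ∀ J .{{_ : ℕ.NonZero J}} b → b ℕ.* J ^ (J ℕ.* b) ℕ.≤ suc J ^ (J ℕ.* b)
power-gap J b = ℕ.*-cancelˡ-≤ J (begin
  J ℕ.* (b ℕ.* J ^ t)        ≡⟨ rearrange J b (J ^ t) ⟩
  J ^ t ℕ.* t                ≤⟨ ℕ.*-monoʳ-≤ (J ^ t) (ℕ.m≤n+m t J) ⟩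
  J ^ t ℕ.* (J ℕ.+ t)        ≤⟨ bernoulli J t ⟩
  J ℕ.* suc J ^ t            ∎)
  where
  open ℕ.≤-Reasoning
  t = J ℕ.* b
  rearrange : ∀ J b P → J ℕ.* (b ℕ.* P) ≡ P ℕ.* (J ℕ.* b)
  rearrange = ℕ.solve-∀

module Differences where
  open import Data.Integer.Base
    using (ℤ; +_; -[1+_]; 0ℤ; 1ℤ; _+_; _-_; _*_; _≤_; _<_; +≤+; -≤+; ∣_∣; nonNegative; positive)
  open import Data.Integer.Properties
  open import Data.Integer.Tactic.RingSolver using (solve-∀)

  Δ : (ℕ → ℤ) → ℕ → ℤ
  Δ f n = f (suc n) - f n

  Δ-step : ∀ f n → f (suc n) ≡ f n + Δ f n
  Δ-step f n = lemma (f (suc n)) (f n)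
    where
    lemma : ∀ a b → a ≡ b + (a - b)
    lemma = solve-∀

  Δ≤-of-nonneg : ∀ f n → 0ℤ ≤ f n → Δ f n ≤ f (suc n)
  Δ≤-of-nonneg f n 0≤fn = i-j≤i (f (suc n)) (f n) {{nonNegative 0≤fn}}

  i≤+∣i∣ : ∀ i → i ≤ + ∣ i ∣
  i≤+∣i∣ (+ n)    = ≤-refl
  i≤+∣i∣ -[1+ n ] = -≤+

  *-monoˡ-≤-0≤ : ∀ {k i j} → 0ℤ ≤ k → i ≤ j → k * i ≤ k * j
  *-monoˡ-≤-0≤ {k} 0≤k = *-monoˡ-≤-nonNeg k {{nonNegative 0≤k}}

  *-monoʳ-≤-0≤ : ∀ {k i j} → 0ℤ ≤ k → i ≤ j → i * k ≤ j * k
  *-monoʳ-≤-0≤ {k} 0≤k = *-monoʳ-≤-nonNeg k {{nonNegative 0≤k}}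

  i≤i+j-0≤ : ∀ i {j} → 0ℤ ≤ j → i ≤ i + j
  i≤i+j-0≤ i {j} 0≤j = i≤i+j i j {{nonNegative 0≤j}}

  0≤i*j : ∀ {i j} → 0ℤ ≤ i → 0ℤ ≤ j → 0ℤ ≤ i * j
  0≤i*j {i} {j} 0≤i 0≤j = subst (_≤ i * j) (*-zeroʳ i) (*-monoˡ-≤-0≤ 0≤i 0≤j)

  telescope : ∀ (f : ℕ → ℤ) b p k → (∀ i → p ℕ.≤ i → i ℕ.< k ℕ.+ p → Δ f i ≤ b) →
              f (k ℕ.+ p) ≤ f p + + k * b
  telescope f b p zero _ = ≤-reflexive (sym (+-identityʳ (f p)))
  telescope f b p (suc k) Δ≤b = begin
    f (suc (k ℕ.+ p))             ≡⟨ Δ-step f (k ℕ.+ p) ⟩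
    f (k ℕ.+ p) + Δ f (k ℕ.+ p)   ≤⟨ +-mono-≤ earlier (Δ≤b (k ℕ.+ p) (ℕ.m≤n+m p k) ℕ.≤-refl) ⟩
    f p + + k * b + b             ≡⟨ shift (f p) (+ k) b ⟩
    f p + + suc k * b             ∎
    where
    open ≤-Reasoning
    earlier : f (k ℕ.+ p) ≤ f p + + k * b
    earlier = telescope f b p k (λ i p≤i i<k+p → Δ≤b i p≤i (ℕ.m<n⇒m<1+n i<k+p))
    shift : ∀ a k b → a + k * b + b ≡ a + (1ℤ + k) * b
    shift = solve-∀

  dominated-by-Δ : ∀ (f : ℕ → ℤ) c L → 1 ℕ.≤ c →
    (∀ n → L ℕ.≤ n → 1ℤ ≤ Δ f n) →
    (∀ i j → L ℕ.≤ i → i ℕ.≤ j → Δ f i ≤ Δ f j) →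
    (∀ n → L ℕ.≤ n → Δ f n + Δ f n ≤ Δ f (c ℕ.+ n)) →
    ∃[ C ] (1 ℕ.≤ C × (∀ n → L ℕ.≤ n → f n ≤ + C * Δ f n))
  dominated-by-Δ f c L 1≤c Δ-pos Δ-mono Δ-doubles =
    D ℕ.+ D , ℕ.≤-trans 1≤D (ℕ.m≤m+n D D) , bounded
    where
    open ≤-Reasoning
    D = ∣ f L ∣ ℕ.+ c
    1≤D : 1 ℕ.≤ D
    1≤D = ℕ.≤-trans 1≤c (ℕ.m≤n+m c ∣ f L ∣)
    Bounded : ℕ → Set
    Bounded n = f n ≤ + (D ℕ.+ D) * Δ f n
    Δ-nonneg : ∀ n → L ℕ.≤ n → 0ℤ ≤ Δ f n
    Δ-nonneg n L≤n = ≤-trans (+≤+ z≤n) (Δ-pos n L≤n)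
    DZ≤2DZ : ∀ Z → 0ℤ ≤ Z → + D * Z ≤ + (D ℕ.+ D) * Z
    DZ≤2DZ Z 0≤Z = *-monoʳ-≤-0≤ 0≤Z (+≤+ (ℕ.m≤m+n D D))
    base : ∀ k → k ℕ.< c → Bounded (k ℕ.+ L)
    base k k<c = begin
      f (k ℕ.+ L)                 ≤⟨ telescope f Z L k (λ i L≤i i<n → Δ-mono i n L≤i (ℕ.<⇒≤ i<n)) ⟩
      f L + + k * Z               ≤⟨ +-mono-≤ fL≤ kZ≤cZ ⟩
      + ∣ f L ∣ * Z + + c * Z     ≡⟨ *-distribʳ-+ Z (+ ∣ f L ∣) (+ c) ⟨
      + D * Z                     ≤⟨ DZ≤2DZ Z 0≤Z ⟩
      + (D ℕ.+ D) * Z             ∎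
      where
      n = k ℕ.+ L
      Z = Δ f n
      L≤n = ℕ.m≤n+m L k
      0≤Z = Δ-nonneg n L≤n
      fL≤ : f L ≤ + ∣ f L ∣ * Z
      fL≤ = ≤-trans (i≤+∣i∣ (f L))
              (≤-trans (≤-reflexive (sym (*-identityʳ (+ ∣ f L ∣))))
                       (*-monoˡ-≤-nonNeg (+ ∣ f L ∣) (Δ-pos n L≤n)))
      kZ≤cZ : + k * Z ≤ + c * Z
      kZ≤cZ = *-monoʳ-≤-0≤ 0≤Z (+≤+ (ℕ.<⇒≤ k<c))
    step : ∀ m → L ℕ.≤ m → Bounded m → Bounded (c ℕ.+ m)
    step m L≤m fm≤ = begin
      f (c ℕ.+ m)                  ≤⟨ telescope f Z m c (λ i m≤i i<n → Δ-mono i n (ℕ.≤-trans L≤m m≤i) (ℕ.<⇒≤ i<n))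
                                    ⟩
      f m + + c * Z                ≤⟨ +-monoˡ-≤ (+ c * Z) fm≤ ⟩
      + (D ℕ.+ D) * W + + c * Z    ≡⟨ cong (_+ + c * Z) (regroup (+ D) W) ⟩
      + D * (W + W) + + c * Z      ≤⟨ +-mono-≤ (*-monoˡ-≤-nonNeg (+ D) (Δ-doubles m L≤m)) cZ≤DZ ⟩
      + D * Z + + D * Z            ≡⟨ *-distribʳ-+ Z (+ D) (+ D) ⟨
      + (D ℕ.+ D) * Z              ∎
      where
      n = c ℕ.+ m
      Z = Δ f n
      W = Δ f m
      cZ≤DZ : + c * Z ≤ + D * Z
      cZ≤DZ = *-monoʳ-≤-0≤ (Δ-nonneg n (ℕ.≤-trans L≤m (ℕ.m≤n+m m c)))
                (+≤+ (ℕ.m≤n+m c ∣ f L ∣))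
      regroup : ∀ d w → (d + d) * w ≡ d * (w + w)
      regroup = solve-∀
    bounded-offset : ∀ k → Bounded (k ℕ.+ L)
    bounded-offset = <-rec (λ k → Bounded (k ℕ.+ L)) go
      where
      go : ∀ k → (∀ {j} → j ℕ.< k → Bounded (j ℕ.+ L)) → Bounded (k ℕ.+ L)
      go k rec with c ℕ.≤? k
      ... | no c≰k = base k (ℕ.≰⇒> c≰k)
      ... | yes c≤k with ℕ.m≤n⇒∃[o]m+o≡n c≤k
      ...   | j , refl = subst Bounded (sym (ℕ.+-assoc c j L))
                           (step (j ℕ.+ L) (ℕ.m≤n+m L j) (rec (ℕ.m<n+m j 1≤c)))
    bounded : ∀ n → L ℕ.≤ n → Bounded n
    bounded n L≤n = subst Bounded (ℕ.m∸n+n≡m L≤n) (bounded-offset (n ∸ L))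

  summand-at-least-half : ∀ {e f s} → e + f ≡ s → s ≤ e + e ⊎ s ≤ f + f
  summand-at-least-half {e} {f} {s} e+f≡s with s ≤? e + e
  ... | yes s≤2e = inj₁ s≤2e
  ... | no  s≰2e = inj₂ (begin
    s                         ≤⟨ i≤i+j-0≤ s (i≤j⇒0≤j-i (<⇒≤ (≰⇒> s≰2e))) ⟩
    s + (s - (e + e))         ≡⟨ cong (λ t → t + (t - (e + e))) e+f≡s ⟨
    (e + f) + ((e + f) - (e + e)) ≡⟨ double e f ⟨
    f + f                     ∎)
    where
    open ≤-Reasoning
    double : ∀ e f → f + f ≡ (e + f) + ((e + f) - (e + e))
    double = solve-∀

  squeezed-ratio : ∀ {a g D x₀ x₁ y₀ y₁} B → 0ℤ ≤ B → 0ℤ < a → B * g ≤ a →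
    0ℤ ≤ x₀ → 0ℤ ≤ x₁ → 0ℤ ≤ y₁ → a * y₀ ≤ D * x₀ → D * x₁ ≤ (a + g) * y₁ →
    B * (x₁ * y₀) ≤ (1ℤ + B) * (y₁ * x₀)
  squeezed-ratio {a} {g} {D} {x₀} {x₁} {y₀} {y₁} B 0≤B 0<a Bg≤a 0≤x₀ 0≤x₁ 0≤y₁ lower upper =
    *-cancelˡ-≤-pos _ _ a {{positive 0<a}} (begin
      a * (B * (x₁ * y₀))          ≡⟨ e₁ a B x₁ y₀ ⟩
      B * (x₁ * (a * y₀))          ≤⟨ *-monoˡ-≤-0≤ 0≤B (*-monoˡ-≤-0≤ 0≤x₁ lower) ⟩
      B * (x₁ * (D * x₀))          ≡⟨ e₂ B x₁ D x₀ ⟩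
      B * (x₀ * (D * x₁))          ≤⟨ *-monoˡ-≤-0≤ 0≤B (*-monoˡ-≤-0≤ 0≤x₀ upper) ⟩
      B * (x₀ * ((a + g) * y₁))    ≡⟨ e₃ B x₀ a g y₁ ⟩
      (B * a + B * g) * (y₁ * x₀)  ≤⟨ *-monoʳ-≤-0≤ (0≤i*j 0≤y₁ 0≤x₀) (+-monoʳ-≤ (B * a) Bg≤a) ⟩
      (B * a + a) * (y₁ * x₀)      ≡⟨ e₄ B a (y₁ * x₀) ⟩
      a * ((1ℤ + B) * (y₁ * x₀))   ∎)
    where
    open ≤-Reasoning
    e₁ : ∀ a B x y → a * (B * (x * y)) ≡ B * (x * (a * y))
    e₁ = solve-∀
    e₂ : ∀ B x D x′ → B * (x * (D * x′)) ≡ B * (x′ * (D * x))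
    e₂ = solve-∀
    e₃ : ∀ B x a g y → B * (x * ((a + g) * y)) ≡ (B * a + B * g) * (y * x)
    e₃ = solve-∀
    e₄ : ∀ B a P → (B * a + a) * P ≡ a * ((1ℤ + B) * P)
    e₄ = solve-∀

module LaggedRecurrence (ψ : ℕ → ℕ) (c : ℕ)
                        (lag : ∀ i → 1 ℕ.≤ i → i ℕ.≤ ψ i ℕ.+ c × ψ i ℕ.< i) where
  open import Data.Integer.Base
    using (ℤ; +_; 0ℤ; 1ℤ; _+_; _-_; -_; _*_; _≤_; _<_; +≤+; +<+)
  open import Data.Integer.Properties
  open import Data.Integer.Tactic.RingSolver using (solve-∀)
  open Differences

  ≤ψ+c : ∀ i → 1 ℕ.≤ i → i ℕ.≤ ψ i ℕ.+ c
  ≤ψ+c i 1≤i = proj₁ (lag i 1≤i)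

  ψ< : ∀ i → 1 ℕ.≤ i → ψ i ℕ.< i
  ψ< i 1≤i = proj₂ (lag i 1≤i)

  1≤c : 1 ℕ.≤ c
  1≤c = ℕ.≤-trans (≤ψ+c 1 ℕ.≤-refl) (ℕ.+-monoˡ-≤ c (ℕ.≤-pred (ψ< 1 ℕ.≤-refl)))

  suc≤+c : ∀ n → suc n ℕ.≤ n ℕ.+ c
  suc≤+c n = ℕ.≤-trans (ℕ.≤-reflexive (ℕ.+-comm 1 n)) (ℕ.+-monoʳ-≤ n 1≤c)

  Solution : ℕ → (ℕ → ℤ) → Set
  Solution N E = ∀ n → N ℕ.≤ n → E (suc n) + E (ψ n) ≡ E n + E n

  Δ-solution : ∀ {N E} → Solution N E → ∀ n → N ℕ.≤ n → Δ E n ≡ E n - E (ψ n)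
  Δ-solution {E = E} sol n N≤n = trans (insert (E (suc n)) (E (ψ n)) (E n))
    (trans (cong (λ s → s - E (ψ n) - E n) (sol n N≤n)) (cancel (E n) (E (ψ n))))
    where
    insert : ∀ a b e → a - e ≡ (a + b) - b - e
    insert = solve-∀
    cancel : ∀ e b → (e + e) - b - e ≡ e - b
    cancel = solve-∀

  solution-combination : ∀ {N U V} p q → Solution N U → Solution N V →
                         Solution N (λ n → p * U n - q * V n)
  solution-combination {U = U} {V} p q solU solV n N≤n =
    trans (collect p q (U (suc n)) (U (ψ n)) (V (suc n)) (V (ψ n)))
      (trans (cong₂ (λ u v → p * u - q * v) (solU n N≤n) (solV n N≤n)) (spread p q (U n) (V n)))
    where
    collect : ∀ p q u u′ v v′ → (p * u - q * v) + (p * u′ - q * v′) ≡ p * (u + u′) - q * (v + v′)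
    collect = solve-∀
    spread : ∀ p q u v → p * (u + u) - q * (v + v) ≡ (p * u - q * v) + (p * u - q * v)
    spread = solve-∀

  -- E is nonnegative and nondecreasing on the window [T − c, T], written T ≤ i + c so that no
  -- truncated subtraction occurs.
  record Rising (E : ℕ → ℤ) (T : ℕ) : Set where
    field
      Δ-nonneg : ∀ i → T ℕ.≤ i ℕ.+ c → i ℕ.< T → 0ℤ ≤ Δ E i
      nonneg   : ∀ i → T ℕ.≤ i ℕ.+ c → i ℕ.≤ T → 0ℤ ≤ E i
  open Rising

  rising-mono : ∀ {E T} → Rising E T → ∀ i j → T ℕ.≤ i ℕ.+ c → i ℕ.≤ j → j ℕ.≤ T → E i ≤ E j
  rising-mono r i zero w z≤n _ = ≤-refl
  rising-mono r i (suc j) w i≤1+j 1+j≤T with ℕ.m≤n⇒m<n∨m≡n i≤1+j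
  ... | inj₂ refl = ≤-refl
  ... | inj₁ i<1+j = ≤-trans (rising-mono r i j w i≤j (ℕ.<⇒≤ 1+j≤T))
                             (0≤i-j⇒j≤i (Δ-nonneg r j (ℕ.≤-trans w (ℕ.+-monoˡ-≤ c i≤j)) 1+j≤T))
    where i≤j = ℕ.≤-pred i<1+j

  rising-≤-top : ∀ {E T} → Rising E T → ∀ i → T ℕ.≤ i ℕ.+ c → i ℕ.≤ T → E i ≤ E T
  rising-≤-top r i w i≤T = rising-mono r i _ w i≤T ℕ.≤-refl

  rising-Δ≤-top : ∀ {E T} → Rising E T → ∀ i → T ℕ.≤ i ℕ.+ c → i ℕ.< T → Δ E i ≤ E T
  rising-Δ≤-top {E} r i w i<T = ≤-trans (Δ≤-of-nonneg E i (nonneg r i w (ℕ.<⇒≤ i<T)))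
                                        (rising-≤-top r (suc i) (ℕ.≤-trans w (ℕ.n≤1+n _)) i<T)

  rising-suc : ∀ {N E m} → Solution N E → N ℕ.≤ suc m → Rising E (suc m) → Rising E (suc (suc m))
  rising-suc {E = E} {m} sol N≤T r = record { Δ-nonneg = Δ-nonneg′ ; nonneg = nonneg′ }
    where
    T = suc m
    0≤ΔT : 0ℤ ≤ Δ E T
    0≤ΔT = subst (0ℤ ≤_) (sym (Δ-solution {E = E} sol T N≤T))
      (i≤j⇒0≤j-i (rising-≤-top r (ψ T) (≤ψ+c T (s≤s z≤n)) (ℕ.<⇒≤ (ψ< T (s≤s z≤n)))))
    Δ-nonneg′ : ∀ i → suc T ℕ.≤ i ℕ.+ c → i ℕ.< suc T → 0ℤ ≤ Δ E i
    Δ-nonneg′ i w i<1+T with ℕ.m≤n⇒m<n∨m≡n (ℕ.≤-pred i<1+T)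
    ... | inj₁ i<T = Δ-nonneg r i (ℕ.≤-trans (ℕ.n≤1+n T) w) i<T
    ... | inj₂ refl = 0≤ΔT
    nonneg′ : ∀ i → suc T ℕ.≤ i ℕ.+ c → i ℕ.≤ suc T → 0ℤ ≤ E i
    nonneg′ i w i≤1+T with ℕ.m≤n⇒m<n∨m≡n i≤1+T
    ... | inj₁ i<1+T = nonneg r i (ℕ.≤-trans (ℕ.n≤1+n T) w) (ℕ.≤-pred i<1+T)
    ... | inj₂ refl = ≤-trans (nonneg r T (ℕ.m≤m+n T c) ℕ.≤-refl) (0≤i-j⇒j≤i 0≤ΔT)

  rising-from : ∀ {N E m} → Solution N E → N ℕ.≤ suc m → Rising E (suc m) →
                ∀ n → m ℕ.≤ n → Rising E (suc n)
  rising-from sol N≤ r zero z≤n = r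
  rising-from sol N≤ r (suc n) m≤1+n with ℕ.m≤n⇒m<n∨m≡n m≤1+n
  ... | inj₂ refl = r
  ... | inj₁ m<1+n = rising-suc sol (ℕ.≤-trans N≤ (s≤s m≤n)) (rising-from sol N≤ r n m≤n)
    where m≤n = ℕ.≤-pred m<1+n

  nonneg-from : ∀ {N E m} → Solution N E → N ℕ.≤ suc m → Rising E (suc m) →
                ∀ n → m ℕ.≤ n → 0ℤ ≤ E n
  nonneg-from sol N≤ r n m≤n = nonneg (rising-from sol N≤ r n m≤n) n (suc≤+c n) (ℕ.n≤1+n n)

  Δ-suc : ∀ {N E m} → Solution N E → N ℕ.≤ suc m → Rising E (suc m) → Δ E m ≤ Δ E (suc m)
  Δ-suc {E = E} {m} sol N≤ r = begin
    E (suc m) - E m                  ≤⟨ +-monoʳ-≤ (E (suc m)) (neg-mono-≤ ψ≤m) ⟩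
    E (suc m) - E (ψ (suc m))        ≡⟨ Δ-solution {E = E} sol (suc m) N≤ ⟨
    Δ E (suc m)                      ∎
    where
    open ≤-Reasoning
    ψ≤m : E (ψ (suc m)) ≤ E m
    ψ≤m = rising-mono r (ψ (suc m)) m (≤ψ+c (suc m) (s≤s z≤n)) (ℕ.≤-pred (ψ< (suc m) (s≤s z≤n))) (ℕ.n≤1+n m)

  Δ-from : ∀ {N E m} → Solution N E → N ℕ.≤ suc m → Rising E (suc m) →
           ∀ n → m ℕ.≤ n → Δ E m ≤ Δ E n
  Δ-from sol N≤ r zero z≤n = ≤-refl
  Δ-from sol N≤ r (suc n) m≤1+n with ℕ.m≤n⇒m<n∨m≡n m≤1+n
  ... | inj₂ refl = ≤-refl
  ... | inj₁ m<1+n = ≤-trans (Δ-from sol N≤ r n m≤n)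
                             (Δ-suc sol (ℕ.≤-trans N≤ (s≤s m≤n)) (rising-from sol N≤ r n m≤n))
    where m≤n = ℕ.≤-pred m<1+n

  rising-cong : ∀ {E F T} → (∀ n → E n ≡ F n) → Rising E T → Rising F T
  rising-cong E≡F r = record
    { Δ-nonneg = λ i w i<T → subst (0ℤ ≤_) (cong₂ _-_ (E≡F (suc i)) (E≡F i)) (Δ-nonneg r i w i<T)
    ; nonneg   = λ i w i≤T → subst (0ℤ ≤_) (E≡F i) (nonneg r i w i≤T)
    }

  rising-scale : ∀ {E T k} → 0ℤ ≤ k → Rising E T → Rising (λ n → k * E n) T
  rising-scale {E} {k = k} 0≤k r = record
    { Δ-nonneg = λ i w i<T → subst (0ℤ ≤_) (factor k (E (suc i)) (E i)) (0≤i*j 0≤k (Δ-nonneg r i w i<T))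
    ; nonneg   = λ i w i≤T → 0≤i*j 0≤k (nonneg r i w i≤T)
    }
    where
    factor : ∀ k a b → k * (a - b) ≡ k * a - k * b
    factor = solve-∀

  rising-minus-small : ∀ {N E V m k g} → Solution N E → N ℕ.≤ suc m → Rising E (suc m) →
                       Rising V (suc m ℕ.+ c) → 0ℤ ≤ k → 0ℤ ≤ g → g * V (suc m ℕ.+ c) ≤ k * Δ E m →
                       Rising (λ n → k * E n - g * V n) (suc m ℕ.+ c)
  rising-minus-small {_} {E} {V} {m} {k} {g} sol N≤ rE rV 0≤k 0≤g gV≤kΔ = record
    { Δ-nonneg = λ i w i<T → subst (0ℤ ≤_) (sym (Δ-difference k g (E (suc i)) (E i) (V (suc i)) (V i)))
                               (i≤j⇒0≤j-i (below (Δ-from sol N≤ rE i (ℕ.<⇒≤ (late w)))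
                                                 (rising-Δ≤-top rV i w i<T)))
    ; nonneg   = λ i w i≤T → i≤j⇒0≤j-i (below (ΔEm≤E i w i≤T) (rising-≤-top rV i w i≤T))
    }
    where
    T = suc m ℕ.+ c
    late : ∀ {i} → T ℕ.≤ i ℕ.+ c → suc m ℕ.≤ i
    late {i} w = ℕ.+-cancelʳ-≤ c (suc m) i w
    below : ∀ {e v} → Δ E m ≤ e → v ≤ V T → g * v ≤ k * e
    below ΔEm≤e v≤VT = ≤-trans (*-monoˡ-≤-0≤ 0≤g v≤VT)
                         (≤-trans gV≤kΔ (*-monoˡ-≤-0≤ 0≤k ΔEm≤e))
    ΔEm≤E : ∀ i → T ℕ.≤ i ℕ.+ c → i ℕ.≤ T → Δ E m ≤ E i
    ΔEm≤E i w i≤T = ≤-trans (Δ≤-of-nonneg E m (nonneg rE m (suc≤+c m) (ℕ.n≤1+n m)))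
                      (rising-mono (rising-from sol N≤ rE (m ℕ.+ c) (ℕ.m≤m+n m c))
                                   (suc m) i ℕ.≤-refl (late w) i≤T)
    Δ-difference : ∀ k g e e′ v v′ → (k * e - g * v) - (k * e′ - g * v′) ≡ k * (e - e′) - g * (v - v′)
    Δ-difference = solve-∀

  rising-excess : ∀ {U V T} → Rising V T →
                  (∀ i → T ℕ.≤ i ℕ.+ c → i ℕ.≤ T → 1ℤ ≤ U i) →
                  (∀ i → T ℕ.≤ i ℕ.+ c → i ℕ.< T → 1ℤ ≤ Δ U i) →
                  Rising (λ n → V T * U n - V n) T
  rising-excess {U} {V} {T} rV 1≤U 1≤ΔU = record
    { Δ-nonneg = λ i w i<T → subst (0ℤ ≤_) (sym (Δ-difference (V T) (U (suc i)) (U i) (V (suc i)) (V i)))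
                               (i≤j⇒0≤j-i (≤-trans (rising-Δ≤-top rV i w i<T) (VT≤VT* (1≤ΔU i w i<T))))
    ; nonneg   = λ i w i≤T → i≤j⇒0≤j-i (≤-trans (rising-≤-top rV i w i≤T) (VT≤VT* (1≤U i w i≤T)))
    }
    where
    VT≤VT* : ∀ {u} → 1ℤ ≤ u → V T ≤ V T * u
    VT≤VT* {u} 1≤u = ≤-trans (≤-reflexive (sym (*-identityʳ (V T))))
                       (*-monoˡ-≤-0≤ (nonneg rV T (ℕ.m≤m+n T c) ℕ.≤-refl) 1≤u)
    Δ-difference : ∀ k u u′ v v′ → (k * u - v) - (k * u′ - v′) ≡ k * (u - u′) - (v - v′)
    Δ-difference = solve-∀

  ExceptionalAfter : ℕ → Set
  ExceptionalAfter n = ∃[ q ] (n ℕ.< q × q ℕ.< n ℕ.+ c × Exc ψ q)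

  ExceptionalWindows : Set
  ExceptionalWindows = Eventually ExceptionalAfter

  exceptional-windows : InF ψ → ExceptionalWindows
  exceptional-windows inF with InF.thetaCond inF
  ... | Nθ , consecutive with InF.infExc inF Nθ
  ... | e₀ , Nθ≤e₀ , exc-e₀ =
    e₀ , λ n e₀≤n → subst ExceptionalAfter (ℕ.m∸n+n≡m e₀≤n) (window-after (n ∸ e₀))
    where
    Exc? : Decidable (Exc ψ)
    Exc? n = (1 ℕ.≤? n) ×-dec (ψ n ℕ.+ 2 ℕ.≤? n)
    next : ∀ p → Nθ ℕ.≤ p → Exc ψ p → ExceptionalAfter p
    next p Nθ≤p exc-p with InF.infExc inF (suc p)
    ... | i , p<i , exc-i
      with least-from Exc? (suc p) (i ∸ suc p) (subst (Exc ψ) (sym (ℕ.m∸n+n≡m p<i)) exc-i)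
    ... | q , p<q , exc-q , none-between = q , p<q , q<p+c , exc-q
      where
      q<p+c : q ℕ.< p ℕ.+ c
      q<p+c = ℕ.≤-trans (s≤s (≤ψ+c q (proj₁ exc-q)))
                (ℕ.+-monoˡ-≤ c (proj₁ (consecutive p q Nθ≤p p<q exc-p exc-q none-between)))
    window-after : ∀ k → ExceptionalAfter (k ℕ.+ e₀)
    window-after zero = next e₀ Nθ≤e₀ exc-e₀
    window-after (suc k) with window-after k
    ... | q , n<q , q<n+c , exc-q with ℕ.m≤n⇒m<n∨m≡n n<q
    ...   | inj₁ 1+n<q = q , 1+n<q , ℕ.m<n⇒m<1+n q<n+c , exc-q
    ...   | inj₂ refl = next (suc (k ℕ.+ e₀)) (ℕ.≤-trans Nθ≤e₀ (ℕ.m≤n+m e₀ (suc k))) exc-q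

  module IncreasingSolution (y : ℕ → ℕ) (y-inc : StrictInc y) (N : ℕ)
                            (y-rec : ∀ n → N ℕ.≤ n → y (suc n) ℕ.+ y (ψ n) ≡ 2 ℕ.* y n) where
    Y : ℕ → ℤ
    Y n = + y n

    Y-solution : Solution N Y
    Y-solution n N≤n = cong +_ (trans (y-rec n N≤n) (cong (y n ℕ.+_) (ℕ.+-identityʳ (y n))))

    Y-nonneg : ∀ n → 0ℤ ≤ Y n
    Y-nonneg n = +≤+ z≤n

    Y-pos : ∀ n → 2 ℕ.≤ n → 1ℤ ≤ Y n
    Y-pos n 2≤n = +≤+ (strictInc-positive y-inc n 2≤n)

    ΔY-pos : ∀ n → 1 ℕ.≤ n → 1ℤ ≤ Δ Y n
    ΔY-pos n 1≤n = subst (_≤ Δ Y n) (cancel 1ℤ (Y n)) (+-monoˡ-≤ (- Y n) (+≤+ (y-inc n 1≤n)))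
      where
      cancel : ∀ a b → a + b - b ≡ a
      cancel = solve-∀

    Y-rising : ∀ T → suc c ℕ.≤ T → Rising Y T
    Y-rising T 1+c≤T = record
      { Δ-nonneg = λ i w _ → ≤-trans (+≤+ z≤n) (ΔY-pos i (ℕ.+-cancelʳ-≤ c 1 i (ℕ.≤-trans 1+c≤T w)))
      ; nonneg   = λ i _ _ → Y-nonneg i
      }

    ΔY-mono : ∀ i j → N ℕ.+ c ℕ.≤ i → i ℕ.≤ j → Δ Y i ≤ Δ Y j
    ΔY-mono i j N+c≤i i≤j =
      Δ-from Y-solution (ℕ.≤-trans (ℕ.m+n≤o⇒m≤o N N+c≤i) (ℕ.n≤1+n i))
             (Y-rising (suc i) (s≤s (ℕ.m+n≤o⇒n≤o N N+c≤i))) j i≤j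

    Y-growth : ∀ k n → N ℕ.≤ n → Y (k ℕ.+ n) ≤ + (2 ^ k) * Y n
    Y-growth zero n _ = ≤-reflexive (sym (*-identityˡ (Y n)))
    Y-growth (suc k) n N≤n = begin
      Y (suc (k ℕ.+ n))                      ≤⟨ i≤i+j _ (Y (ψ (k ℕ.+ n))) ⟩
      Y (suc (k ℕ.+ n)) + Y (ψ (k ℕ.+ n))    ≡⟨ Y-solution (k ℕ.+ n) (ℕ.≤-trans N≤n (ℕ.m≤n+m n k)) ⟩
      Y (k ℕ.+ n) + Y (k ℕ.+ n)              ≤⟨ +-mono-≤ (Y-growth k n N≤n) (Y-growth k n N≤n) ⟩
      + (2 ^ k) * Y n + + (2 ^ k) * Y n      ≡⟨ double (+ (2 ^ k)) (Y n) ⟩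
      (+ 2 * + (2 ^ k)) * Y n                ≡⟨ cong (_* Y n) (pos-* 2 (2 ^ k)) ⟨
      + (2 ^ suc k) * Y n                    ∎
      where
      open ≤-Reasoning
      double : ∀ a b → a * b + a * b ≡ ((1ℤ + 1ℤ) * a) * b
      double = solve-∀

    module _ (windows : ExceptionalWindows) where
      L : ℕ
      L = (N ℕ.+ suc c) ⊔ proj₁ windows

      L≤⇒N+1+c≤ : ∀ {n} → L ℕ.≤ n → N ℕ.+ suc c ℕ.≤ n
      L≤⇒N+1+c≤ = ℕ.m⊔n≤o⇒m≤o (N ℕ.+ suc c) (proj₁ windows)

      L≤⇒N+c≤ : ∀ {n} → L ℕ.≤ n → N ℕ.+ c ℕ.≤ n
      L≤⇒N+c≤ L≤n = ℕ.≤-trans (ℕ.+-monoʳ-≤ N (ℕ.n≤1+n c)) (L≤⇒N+1+c≤ L≤n)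

      ΔY-doubles : ∀ n → L ℕ.≤ n → Δ Y n + Δ Y n ≤ Δ Y (c ℕ.+ n)
      ΔY-doubles n L≤n
        with proj₂ windows (suc n) (ℕ.≤-trans (ℕ.m⊔n≤o⇒n≤o (N ℕ.+ suc c) _ L≤n) (ℕ.n≤1+n n))
      ... | suc (suc r) , s≤s (s≤s n≤r) , q<1+n+c , exc-q = begin
        Δ Y n + Δ Y n           ≤⟨ +-mono-≤ (ΔY-mono n (suc r) N+c≤n (ℕ.m≤n⇒m≤1+n n≤r))
                                            (ΔY-mono n r N+c≤n n≤r) ⟩
        Δ Y (suc r) + Δ Y r     ≡⟨ chain (Y q) (Y (suc r)) (Y r) ⟩
        Y q - Y r               ≤⟨ +-monoʳ-≤ (Y q) (neg-mono-≤ Yψq≤Yr) ⟩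
        Y q - Y (ψ q)           ≡⟨ Δ-solution {E = Y} Y-solution q N≤q ⟨
        Δ Y q                   ≤⟨ ΔY-mono q (c ℕ.+ n) (ℕ.≤-trans N+c≤n n≤q) q≤c+n ⟩
        Δ Y (c ℕ.+ n)           ∎
        where
        open ≤-Reasoning
        q = suc (suc r)
        N+c≤n = L≤⇒N+c≤ L≤n
        r≤q = ℕ.≤-trans (ℕ.n≤1+n r) (ℕ.n≤1+n (suc r))
        n≤q = ℕ.≤-trans n≤r r≤q
        N≤q = ℕ.≤-trans (ℕ.m+n≤o⇒m≤o N N+c≤n) n≤q
        q≤c+n : q ℕ.≤ c ℕ.+ n
        q≤c+n = ℕ.≤-trans (ℕ.≤-pred q<1+n+c) (ℕ.≤-reflexive (ℕ.+-comm n c))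
        ψq≤r : ψ q ℕ.≤ r
        ψq≤r = ℕ.+-cancelʳ-≤ 2 (ψ q) r (ℕ.≤-trans (proj₂ exc-q) (ℕ.≤-reflexive (ℕ.+-comm 2 r)))
        Yψq≤Yr : Y (ψ q) ≤ Y r
        Yψq≤Yr = rising-≤-top (Y-rising r (ℕ.≤-trans (ℕ.m+n≤o⇒n≤o N (L≤⇒N+1+c≤ L≤n)) n≤r)) (ψ q)
                   (ℕ.≤-trans r≤q (≤ψ+c q (s≤s z≤n))) ψq≤r
        chain : ∀ a b e → (a - b) + (b - e) ≡ a - e
        chain = solve-∀

      Y-dominated : ∃[ C ] (1 ℕ.≤ C × (∀ n → L ℕ.≤ n → Y n ≤ + C * Δ Y n))
      Y-dominated = dominated-by-Δ Y c L 1≤c ΔY-pos′ (λ i j L≤i → ΔY-mono i j (L≤⇒N+c≤ L≤i)) ΔY-doubles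
        where
        ΔY-pos′ : ∀ n → L ℕ.≤ n → 1ℤ ≤ Δ Y n
        ΔY-pos′ n L≤n = ΔY-pos n (ℕ.≤-trans (s≤s z≤n) (ℕ.m+n≤o⇒n≤o N (L≤⇒N+1+c≤ L≤n)))

      Y-ahead-dominated : ∃[ C ] Eventually (λ m → Y (suc m ℕ.+ c) ≤ + C * Δ Y m)
      Y-ahead-dominated with Y-dominated
      ... | C , _ , bound = 2 ^ suc c ℕ.* C , L , λ m L≤m → begin
        Y (suc m ℕ.+ c)               ≡⟨ cong (λ k → Y (suc k)) (ℕ.+-comm m c) ⟩
        Y (suc c ℕ.+ m)               ≤⟨ Y-growth (suc c) m (ℕ.m+n≤o⇒m≤o N (L≤⇒N+c≤ L≤m)) ⟩
        + (2 ^ suc c) * Y m           ≤⟨ *-monoˡ-≤-nonNeg (+ (2 ^ suc c)) (bound m L≤m) ⟩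
        + (2 ^ suc c) * (+ C * Δ Y m) ≡⟨ *-assoc (+ (2 ^ suc c)) (+ C) (Δ Y m) ⟨
        + (2 ^ suc c) * + C * Δ Y m   ≡⟨ cong (_* Δ Y m) (pos-* (2 ^ suc c) C) ⟨
        + (2 ^ suc c ℕ.* C) * Δ Y m   ∎
        where open ≤-Reasoning

      liminf-above-one : LiminfAboveOne y
      liminf-above-one with Y-dominated
      ... | C , 1≤C , bound = suc C , C , 1≤C , ℕ.≤-refl , L , λ n L≤n → drop‿+≤+ (begin
        + (suc C ℕ.* y n)         ≡⟨ cong (λ t → Y n + t) (pos-* C (y n)) ⟩
        Y n + + C * Y n           ≤⟨ +-monoˡ-≤ (+ C * Y n) (bound n L≤n) ⟩
        + C * Δ Y n + + C * Y n   ≡⟨ recombine (+ C) (Y n) (Y (suc n)) ⟩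
        + C * Y (suc n)           ≡⟨ pos-* C (y (suc n)) ⟨
        + (C ℕ.* y (suc n))       ∎)
        where
        open ≤-Reasoning
        recombine : ∀ C a b → C * (b - a) + C * a ≡ C * b
        recombine = solve-∀

  module Squeeze (x y : ℕ → ℕ) (N : ℕ)
                 (x-inc : StrictInc x) (x-rec : ∀ n → N ℕ.≤ n → x (suc n) ℕ.+ x (ψ n) ≡ 2 ℕ.* x n)
                 (y-inc : StrictInc y) (y-rec : ∀ n → N ℕ.≤ n → y (suc n) ℕ.+ y (ψ n) ≡ 2 ℕ.* y n)
                 (C : ℕ) (y-ahead : ∀ m → N ℕ.≤ m → + y (suc m ℕ.+ c) ≤ + C * Δ (λ n → + y n) m) where
    open IncreasingSolution y y-inc N y-rec using (Y; Y-solution; Y-nonneg; Y-pos; ΔY-pos; Y-rising)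
    open IncreasingSolution x x-inc N x-rec using ()
      renaming ( Y to X; Y-solution to X-solution; Y-nonneg to X-nonneg
               ; Y-pos to X-pos; ΔY-pos to ΔX-pos; Y-rising to X-rising)

    J K : ℕ
    J = suc (C ℕ.+ C)
    K = suc J

    lower upper : ℤ → ℤ → ℕ → ℤ
    lower D a n = D * X n - a * Y n
    upper D b n = b * Y n - D * X n

    lower-solution : ∀ D a → Solution N (lower D a)
    lower-solution D a = solution-combination D a X-solution Y-solution

    upper-solution : ∀ D b → Solution N (upper D b)
    upper-solution D b = solution-combination b D Y-solution X-solution

    Δlower+Δupper : ∀ D a g n → Δ (lower D a) n + Δ (upper D (a + g)) n ≡ g * Δ Y n
    Δlower+Δupper D a g n = sum D a g (X n) (X (suc n)) (Y n) (Y (suc n))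
      where
      sum : ∀ D a g x x′ y y′ → ((D * x′ - a * y′) - (D * x - a * y)) +
                                (((a + g) * y′ - D * x′) - ((a + g) * y - D * x)) ≡ g * (y′ - y)
      sum = solve-∀

    advance : ∀ {E F m g} → Solution N E → Solution N F → N ℕ.≤ m → Rising E (suc m) → Rising F (suc m) →
              0ℤ ≤ g → g * Δ Y m ≤ Δ E m + Δ E m →
              Rising (λ n → + K * E n - g * Y n) (suc m ℕ.+ c) × Rising (λ n → + K * F n) (suc m ℕ.+ c)
    advance {E} {_} {m} {g} solE solF N≤m rE rF 0≤g g≤2ΔE =
        rising-minus-small {k = + K} solE N≤1+m rE (Y-rising (suc m ℕ.+ c) (s≤s (ℕ.m≤n+m c m)))
          (+≤+ z≤n) 0≤g amplified
      , rising-scale {k = + K} (+≤+ z≤n) (rising-from solF N≤1+m rF (m ℕ.+ c) (ℕ.m≤m+n m c))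
      where
      open ≤-Reasoning
      N≤1+m = ℕ.≤-trans N≤m (ℕ.n≤1+n m)
      0≤ΔE : 0ℤ ≤ Δ E m
      0≤ΔE = Δ-nonneg rE m (suc≤+c m) ℕ.≤-refl
      amplified : g * Y (suc m ℕ.+ c) ≤ + K * Δ E m
      amplified = begin
        g * Y (suc m ℕ.+ c)      ≤⟨ *-monoˡ-≤-0≤ 0≤g (y-ahead m N≤m) ⟩
        g * (+ C * Δ Y m)        ≡⟨ swap g (+ C) (Δ Y m) ⟩
        + C * (g * Δ Y m)        ≤⟨ *-monoˡ-≤-nonNeg (+ C) g≤2ΔE ⟩
        + C * (Δ E m + Δ E m)    ≡⟨ regroup (+ C) (Δ E m) ⟩
        + (C ℕ.+ C) * Δ E m      ≤⟨ *-monoʳ-≤-0≤ 0≤ΔE (+≤+ (ℕ.≤-trans (ℕ.n≤1+n _) (ℕ.n≤1+n J))) ⟩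
        + K * Δ E m              ∎
        where
        swap : ∀ g c d → g * (c * d) ≡ c * (g * d)
        swap = solve-∀
        regroup : ∀ c e → c * (e + e) ≡ (c + c) * e
        regroup = solve-∀

    T₀ G₀ : ℕ
    T₀ = suc (N ℕ.+ suc c)
    G₀ = x T₀ ℕ.* y T₀

    -- D·X − a·Y and (a + g)·Y − D·X lie in the invariant cone, so a·Y ≤ D·X ≤ (a + g)·Y from m on;
    -- every round multiplies a by at least K but g only by J = K − 1.
    record Bracket (t : ℕ) : Set where
      field
        m            : ℕ
        D a g        : ℤ
        N≤m          : N ℕ.≤ m
        lower-rising : Rising (lower D a) (suc m)
        upper-rising : Rising (upper D (a + g)) (suc m)
        0≤g          : 0ℤ ≤ g
        g≤           : g ≤ + (J ^ t ℕ.* G₀)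
        K^t≤a        : + (K ^ t) ≤ a

    initial : Bracket 0
    initial = record
      { m            = N ℕ.+ suc c
      ; D            = Y T₀
      ; a            = 1ℤ
      ; g            = + G₀ - 1ℤ
      ; N≤m          = ℕ.m≤m+n N (suc c)
      ; lower-rising = rising-cong (λ n → cong (λ t → Y T₀ * X n - t) (sym (*-identityˡ (Y n))))
                         (rising-excess (Y-rising T₀ 1+c≤T₀) (λ i w _ → X-pos i (2≤ w))
                                                               (λ i w _ → ΔX-pos i (1≤ w)))
      ; upper-rising = rising-cong upper-form
                         (rising-scale (Y-nonneg T₀)
                           (rising-excess (X-rising T₀ 1+c≤T₀) (λ i w _ → Y-pos i (2≤ w))
                                                               (λ i w _ → ΔY-pos i (1≤ w))))
      ; 0≤g          = i≤j⇒0≤j-i (+≤+ 1≤G₀)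
      ; g≤           = ≤-trans (i-j≤i (+ G₀) 1ℤ) (≤-reflexive (cong +_ (sym (ℕ.*-identityˡ G₀))))
      ; K^t≤a        = ≤-refl
      }
      where
      1+c≤T₀ : suc c ℕ.≤ T₀
      1+c≤T₀ = s≤s (ℕ.≤-trans (ℕ.n≤1+n c) (ℕ.m≤n+m (suc c) N))
      2≤ : ∀ {i} → T₀ ℕ.≤ i ℕ.+ c → 2 ℕ.≤ i
      2≤ {i} w = ℕ.+-cancelʳ-≤ c 2 i (ℕ.≤-trans (s≤s (ℕ.m≤n+m (suc c) N)) w)
      1≤ : ∀ {i} → T₀ ℕ.≤ i ℕ.+ c → 1 ℕ.≤ i
      1≤ w = ℕ.≤-trans (s≤s z≤n) (2≤ w)
      2≤T₀ = 2≤ (ℕ.m≤m+n T₀ c)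
      1≤G₀ : 1 ℕ.≤ G₀
      1≤G₀ = ℕ.*-mono-≤ (strictInc-positive x-inc T₀ 2≤T₀) (strictInc-positive y-inc T₀ 2≤T₀)
      upper-form : ∀ n → Y T₀ * (X T₀ * Y n - X n) ≡ upper (Y T₀) (1ℤ + (+ G₀ - 1ℤ)) n
      upper-form n = trans (expand (X T₀) (Y T₀) (X n) (Y n))
        (cong (λ G → (1ℤ + (G - 1ℤ)) * Y n - Y T₀ * X n) (sym (pos-* (x T₀) (y T₀))))
        where
        expand : ∀ xT yT x y → yT * (xT * y - x) ≡ (1ℤ + (xT * yT - 1ℤ)) * y - yT * x
        expand = solve-∀

    g-next : ∀ {t g} → g ≤ + (J ^ t ℕ.* G₀) → + J * g ≤ + (J ^ suc t ℕ.* G₀)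
    g-next {t} g≤ = ≤-trans (*-monoˡ-≤-nonNeg (+ J) g≤)
      (≤-reflexive (trans (sym (pos-* J _)) (cong +_ (sym (ℕ.*-assoc J (J ^ t) G₀)))))

    a-next : ∀ {t a} → + (K ^ t) ≤ a → + (K ^ suc t) ≤ + K * a
    a-next {t} K^t≤a = ≤-trans (≤-reflexive (pos-* K (K ^ t))) (*-monoˡ-≤-nonNeg (+ K) K^t≤a)

    step : ∀ {t} → Bracket t → Bracket (suc t)
    step {t} br = advance-by (summand-at-least-half {ΔE} {ΔF} (Δlower+Δupper D a g m))
      where
      open Bracket br
      ΔE = Δ (lower D a) m
      ΔF = Δ (upper D (a + g)) m
      N≤m+c = ℕ.≤-trans N≤m (ℕ.m≤m+n m c)
      0≤Jg = 0≤i*j {+ J} (+≤+ z≤n) 0≤g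
      advance-by : g * Δ Y m ≤ ΔE + ΔE ⊎ g * Δ Y m ≤ ΔF + ΔF → Bracket (suc t)
      advance-by (inj₁ g≤2ΔE) = record
        { m = m ℕ.+ c ; D = + K * D ; a = + K * a + g ; g = + J * g ; N≤m = N≤m+c
        ; lower-rising = rising-cong (λ n → scaled-lower-minus (+ K) D a g (X n) (Y n)) (proj₁ advanced)
        ; upper-rising = rising-cong (λ n → scaled-upper (+ J) D a g (X n) (Y n)) (proj₂ advanced)
        ; 0≤g = 0≤Jg
        ; g≤ = g-next {t} {g} g≤
        ; K^t≤a = ≤-trans (a-next {t} {a} K^t≤a) (i≤i+j-0≤ _ 0≤g)
        }
        where
        advanced = advance (lower-solution D a) (upper-solution D (a + g)) N≤m
                     lower-rising upper-rising 0≤g g≤2ΔE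
        scaled-lower-minus : ∀ k D a g x y → k * (D * x - a * y) - g * y ≡ (k * D) * x - (k * a + g) * y
        scaled-lower-minus = solve-∀
        scaled-upper : ∀ j D a g x y → (1ℤ + j) * ((a + g) * y - D * x) ≡
                                       (((1ℤ + j) * a + g) + j * g) * y - ((1ℤ + j) * D) * x
        scaled-upper = solve-∀
      advance-by (inj₂ g≤2ΔF) = record
        { m = m ℕ.+ c ; D = + K * D ; a = + K * a ; g = + J * g ; N≤m = N≤m+c
        ; lower-rising = rising-cong (λ n → scaled-lower (+ K) D a (X n) (Y n)) (proj₂ advanced)
        ; upper-rising = rising-cong (λ n → scaled-upper-minus (+ J) D a g (X n) (Y n)) (proj₁ advanced)
        ; 0≤g = 0≤Jg
        ; g≤ = g-next {t} {g} g≤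
        ; K^t≤a = a-next {t} {a} K^t≤a
        }
        where
        advanced = advance (upper-solution D (a + g)) (lower-solution D a) N≤m
                     upper-rising lower-rising 0≤g g≤2ΔF
        scaled-lower : ∀ k D a x y → k * (D * x - a * y) ≡ (k * D) * x - (k * a) * y
        scaled-lower = solve-∀
        scaled-upper-minus : ∀ j D a g x y → (1ℤ + j) * ((a + g) * y - D * x) - g * y ≡
                                             ((1ℤ + j) * a + j * g) * y - ((1ℤ + j) * D) * x
        scaled-upper-minus = solve-∀

    bracket : ∀ t → Bracket t
    bracket zero    = initial
    bracket (suc t) = step (bracket t)

    ratio-comparison : ∀ B → Eventually (λ n → B ℕ.* (x (suc n) ℕ.* y n) ℕ.≤ suc B ℕ.* (y (suc n) ℕ.* x n))
    ratio-comparison B = m , λ n m≤n → drop‿+≤+ (subst₂ _≤_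
      (sym (pos-*-* B (x (suc n)) (y n))) (sym (pos-*-* (suc B) (y (suc n)) (x n)))
      (squeezed-ratio {a} {g} {D} {X n} {X (suc n)} {Y n} {Y (suc n)} (+ B) (+≤+ z≤n) 0<a Bg≤a
        (X-nonneg n) (X-nonneg (suc n)) (Y-nonneg (suc n))
        (0≤i-j⇒j≤i (nonneg-from (lower-solution D a) N≤1+m lower-rising n m≤n))
        (0≤i-j⇒j≤i (nonneg-from (upper-solution D (a + g)) N≤1+m upper-rising
                                (suc n) (ℕ.m≤n⇒m≤1+n m≤n)))))
      where
      t = J ℕ.* (B ℕ.* G₀)
      open Bracket (bracket t)
      open ≤-Reasoning
      N≤1+m = ℕ.≤-trans N≤m (ℕ.n≤1+n m)
      0<a : 0ℤ < a
      0<a = <-≤-trans (+<+ (ℕ.m^n>0 K t)) K^t≤a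
      Bg≤a : + B * g ≤ a
      Bg≤a = begin
        + B * g                    ≤⟨ *-monoˡ-≤-nonNeg (+ B) g≤ ⟩
        + B * + (J ^ t ℕ.* G₀)     ≡⟨ pos-* B _ ⟨
        + (B ℕ.* (J ^ t ℕ.* G₀))   ≡⟨ cong +_ (regroup B (J ^ t) G₀) ⟩
        + (B ℕ.* G₀ ℕ.* J ^ t)     ≤⟨ +≤+ (power-gap J (B ℕ.* G₀)) ⟩
        + (K ^ t)                  ≤⟨ K^t≤a ⟩
        a                          ∎
        where
        regroup : ∀ B P G → B ℕ.* (P ℕ.* G) ≡ B ℕ.* G ℕ.* P
        regroup = ℕ.solve-∀
      pos-*-* : ∀ k u v → + (k ℕ.* (u ℕ.* v)) ≡ + k * (+ u * + v)
      pos-*-* k u v = trans (pos-* k _) (cong (+ k *_) (pos-* u v))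

  ratio-comparison : ExceptionalWindows → ∀ {x y} → StrictInc x → EventRec ψ x → StrictInc y → EventRec ψ y →
                     ∀ B → Eventually (λ n → B ℕ.* (x (suc n) ℕ.* y n) ℕ.≤ suc B ℕ.* (y (suc n) ℕ.* x n))
  ratio-comparison windows {x} {y} x-inc x-rec y-inc (Ny , y-rec)
    with IncreasingSolution.Y-ahead-dominated y y-inc Ny y-rec windows
  ... | C , y-ahead with eventually-× x-rec (eventually-× (Ny , y-rec) y-ahead)
  ... | N , hyps = Squeeze.ratio-comparison x y N
                     x-inc (λ n N≤n → proj₁ (hyps n N≤n))
                     y-inc (λ n N≤n → proj₁ (proj₂ (hyps n N≤n)))
                     C (λ n N≤n → proj₂ (proj₂ (hyps n N≤n)))

  liminf-above-one : ExceptionalWindows → ∀ {y} → StrictInc y → EventRec ψ y → LiminfAboveOne y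
  liminf-above-one windows {y} y-inc (N , y-rec) =
    IncreasingSolution.liminf-above-one y y-inc N y-rec windows

open import Data.Nat.Base using (_≤_; _<_; _*_)

ratio-margin : ∀ {X Y} → X < Y → suc (suc X) * X < suc X * Y
ratio-margin {X} X<Y = ℕ.≤-trans (ℕ.≤-reflexive (square X)) (ℕ.*-monoʳ-≤ (suc X) X<Y)
  where
  square : ∀ X → suc (suc (suc X) * X) ≡ suc X * suc X
  square = ℕ.solve-∀

limsup-below-transfer : ∀ x y → Eventually (λ n → 1 ≤ y n) →
  (∀ B → Eventually (λ n → B * (x (suc n) * y n) ≤ suc B * (y (suc n) * x n))) →
  ∀ p s → LimsupBelow y p s → LimsupBelow x p s
limsup-below-transfer x y y-pos ratio p s (p′ , s′ , 1≤s′ , p′s<ps′ , y-bound) =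
  suc B * p′ , B * s′ , ℕ.*-mono-≤ {1} {B} (s≤s z≤n) 1≤s′ , margin , proj₁ hyps , x-bound
  where
  B = suc (p′ * s)
  hyps = eventually-× y-pos (eventually-× (ratio B) y-bound)
  margin : suc B * p′ * s < p * (B * s′)
  margin = subst₂ _<_ (sym (ℕ.*-assoc (suc B) p′ s)) (swap B p s′) (ratio-margin p′s<ps′)
    where
    swap : ∀ B p s′ → B * (p * s′) ≡ p * (B * s′)
    swap = ℕ.solve-∀
  x-bound : ∀ n → proj₁ hyps ≤ n → B * s′ * x (suc n) ≤ suc B * p′ * x n
  x-bound n N≤n with proj₂ hyps n N≤n
  ... | 1≤yn , x-vs-y , y-n = ℕ.*-cancelˡ-≤ (y n) {{ℕ.>-nonZero 1≤yn}} (begin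
    y n * (B * s′ * x (suc n))         ≡⟨ e₁ (y n) B s′ (x (suc n)) ⟩
    s′ * (B * (x (suc n) * y n))       ≤⟨ ℕ.*-monoʳ-≤ s′ x-vs-y ⟩
    s′ * (suc B * (y (suc n) * x n))   ≡⟨ e₂ s′ (suc B) (y (suc n)) (x n) ⟩
    suc B * x n * (s′ * y (suc n))     ≤⟨ ℕ.*-monoʳ-≤ (suc B * x n) y-n ⟩
    suc B * x n * (p′ * y n)           ≡⟨ e₃ (suc B) (x n) p′ (y n) ⟩
    y n * (suc B * p′ * x n)           ∎)
    where
    open ℕ.≤-Reasoning
    e₁ : ∀ y B s x → y * (B * s * x) ≡ s * (B * (x * y))
    e₁ = ℕ.solve-∀
    e₂ : ∀ s A y x → s * (A * (y * x)) ≡ A * x * (s * y)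
    e₂ = ℕ.solve-∀
    e₃ : ∀ A x p y → A * x * (p * y) ≡ y * (A * p * x)
    e₃ = ℕ.solve-∀

lemma5p3 : (ψ : ℕ → ℕ) → InF ψ → (u : ℕ → ℕ) →
    StrictInc u → (∀ n → 1 ≤ n → 1 ≤ u n) → EventRec ψ u →
    LiminfAboveOne u × LimsupIsDelta ψ u
-- Positivity of u is needed only from index 2 on, where it follows from strict monotonicity.
lemma5p3 ψ inF u u-inc _ u-rec with InF.bounded inF
... | c , lag = liminf-above-one windows u-inc u-rec , limsup-is-delta
  where
  open LaggedRecurrence ψ c lag
  windows : ExceptionalWindows
  windows = exceptional-windows inF
  transfer : ∀ {x y} → StrictInc x → EventRec ψ x → StrictInc y → EventRec ψ y →
             ∀ p s → LimsupBelow y p s → LimsupBelow x p s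
  transfer {x} {y} x-inc x-rec y-inc y-rec = limsup-below-transfer x y (2 , strictInc-positive y-inc)
                                               (ratio-comparison windows x-inc x-rec y-inc y-rec)
  limsup-is-delta : LimsupIsDelta ψ u
  limsup-is-delta m m-inc m-rec p s _ = mk⇔ (transfer m-inc m-rec u-inc u-rec p s) (transfer u-inc u-rec m-inc m-rec p s)
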